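{- Let $n\ge1$. In unlabeled chip-firing on the infinite binary tree with a self-loop at the root, starting with $2^n-1$ chips at the root, every firing sequence leading from the initial configuration to the terminal configuration consists of exactly $2^n(n-3)+n+3$ firing moves.
   Context: The infinite binary tree has nodes labeled by positive integers: node $1$ is the root, node $i$ has children $2i$ and $2i+1$ and (for $i>1$) parent $\lfloor i/2\rfloor$. A self-loop is added at the root, so every node has degree $3$. Unlabeled chip-firing: a node with at least $3$ (indistinguishable) chips may fire, sending one chip to each of its two children and one to its parent (the root sends this chip to itself). A configuration is terminal if no node has $3$ or more chips. -}

module Defs where

open import Data.Nat using (ℕ; zero; suc; _+_; _*_; _∸_; _^_; _≤_; _<_; _≡ᵇ_; _/_)
open import Data.Bool using (Bool; true; false; if_then_else_)
open import Data.List using (List; []; _∷_)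
open import Data.Product using (_×_)
open import Data.Unit using (⊤)

-- Nodes of the infinite binary tree are positive integers; node 1 is the root,
-- node i has children 2i and 2i+1 and (for i > 1) parent ⌊i/2⌋.
-- A configuration assigns a number of chips to every node (index 0 is unused).
Config : Set
Config = ℕ → ℕ

-- Parent of a node; the root's "parent" is itself (the self-loop at the root).
parent : ℕ → ℕ
parent 0 = 0
parent 1 = 1
parent (suc (suc k)) = (suc (suc k)) / 2

ind : Bool → ℕ
ind true  = 1
ind false = 0

fire : Config → ℕ → Config
fire c i j =
  (if j ≡ᵇ i then c j ∸ 3 else c j)
  + ind (j ≡ᵇ 2 * i) + ind (j ≡ᵇ 2 * i + 1) + ind (j ≡ᵇ parent i)

LegalSeq : Config → List ℕ → Set
LegalSeq c []       = ⊤
LegalSeq c (i ∷ is) = (1 ≤ i) × (3 ≤ c i) × LegalSeq (fire c i) is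

fireAll : Config → List ℕ → Config
fireAll c []       = c
fireAll c (i ∷ is) = fireAll (fire c i) is

Terminal : Config → Set
Terminal c = (i : ℕ) → 1 ≤ i → c i < 3

initial : ℕ → Config
initial n j = if j ≡ᵇ 1 then 2 ^ n ∸ 1 else 0

-- Least action principle: a legal firing sequence that reaches a terminal configuration is at least as
-- long as every legal firing sequence from the same configuration (a move that is legal now stays legal
-- until it is performed, and it commutes with the moves before it). Hence all sequences from the initial
-- configuration to a terminal one have the same length, and it suffices to count the moves of one of them.
-- With 2^(n+1) - 1 chips at the root, fire the root 2^n - 1 times: one chip stays at the root and each child
-- holds 2^n - 1 chips. From then on both subtrees replay the sequence for 2^n - 1 chips simultaneously,
-- a firing of the subtree roots being completed by one firing of the root. This ends with one chip on each
-- node of depth < n + 1, and the move count satisfies L(n+1) = (2^n - 1) + 2 L(n) + R(n), where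
-- R(n) = 2^n - 1 - n is the number of root firings; hence L(n) = 2^n (n - 3) + n + 3.
module Submission where

open import Data.Bool using (Bool; true; false; not; if_then_else_)
import Data.Bool.Properties as Bool
open import Data.List using (List; []; _∷_; _++_; _∷ʳ_; length; concatMap; replicate)
open import Data.List.Properties using (≡-dec; length-++; length-replicate)
open import Data.List.Relation.Unary.All using (All; []; _∷_)
import Data.List.Relation.Unary.First as First
import Data.List.Relation.Unary.First.Properties as First
open import Data.Product using (_×_; _,_; proj₁; proj₂; ∃-syntax)
open import Data.Sum as Sum using (_⊎_; inj₁; inj₂)
open import Data.Unit using (⊤; tt)
open import Function using (id; _∘_)
open import Relation.Binary.Definitions using (DecidableEquality)
open import Relation.Binary.PropositionalEquality
open import Relation.Nullary using (does; yes; no; contradiction)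
open import Relation.Nullary.Decidable using (dec-true; dec-false; toSum)

import Defs
open Defs using (ind)

module ChipFiring {V : Set} (_≟_ : DecidableEquality V) (left right up : V → V) (IsNode : V → Set) where

  open import Data.Nat using (ℕ; suc; _+_; _*_; _∸_; _≤_; _<_; z≤n; s≤s)
  open import Data.Nat.Properties
    using ( ≤-refl; ≤-trans; ≤-antisym; module ≤-Reasoning; m≤m+n; <⇒≱
          ; +-assoc; +-comm; +-cancelʳ-≡; m∸n+n≡m )
  open import Data.Nat.Tactic.RingSolver using (solve-∀)

  Configuration : Set
  Configuration = V → ℕ

  fire : Configuration → V → Configuration
  fire c i j = (if does (j ≟ i) then c j ∸ 3 else c j)
    + ind (does (j ≟ left i)) + ind (does (j ≟ right i)) + ind (does (j ≟ up i))

  Legal : Configuration → List V → Set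
  Legal c []       = ⊤
  Legal c (i ∷ σ) = IsNode i × 3 ≤ c i × Legal (fire c i) σ

  fireAll : Configuration → List V → Configuration
  fireAll c []       = c
  fireAll c (i ∷ σ) = fireAll (fire c i) σ

  Terminal : Configuration → Set
  Terminal c = ∀ i → IsNode i → c i < 3

  infix 4 _─[_]→_

  _─[_]→_ : Configuration → List V → Configuration → Set
  c ─[ σ ]→ d = Legal c σ × fireAll c σ ≗ d

  fire-cong : ∀ {c d} i → c ≗ d → fire c i ≗ fire d i
  fire-cong i c≗d j rewrite c≗d j = refl

  fireAll-cong : ∀ {c d} σ → c ≗ d → fireAll c σ ≗ fireAll d σ
  fireAll-cong []      c≗d = c≗d
  fireAll-cong (i ∷ σ) c≗d = fireAll-cong σ (fire-cong i c≗d)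

  Legal-cong : ∀ {c d} σ → c ≗ d → Legal c σ → Legal d σ
  Legal-cong []      c≗d _                = tt
  Legal-cong (i ∷ σ) c≗d (isNode , ci≥3 , l) =
    isNode , subst (3 ≤_) (c≗d i) ci≥3 , Legal-cong σ (fire-cong i c≗d) l

  fireAll-++ : ∀ c σ τ → fireAll c (σ ++ τ) ≡ fireAll (fireAll c σ) τ
  fireAll-++ c []      τ = refl
  fireAll-++ c (i ∷ σ) τ = fireAll-++ (fire c i) σ τ

  Legal-++ : ∀ c σ τ → Legal c σ → Legal (fireAll c σ) τ → Legal c (σ ++ τ)
  Legal-++ c []      τ _                lτ = lτ
  Legal-++ c (i ∷ σ) τ (isNode , ci≥3 , lσ) lτ = isNode , ci≥3 , Legal-++ (fire c i) σ τ lσ lτ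

  reaches-[] : ∀ {c d} → c ≗ d → c ─[ [] ]→ d
  reaches-[] c≗d = tt , c≗d

  reaches-∷ : ∀ {c i σ d} → IsNode i → 3 ≤ c i → fire c i ─[ σ ]→ d → c ─[ i ∷ σ ]→ d
  reaches-∷ isNode ci≥3 (l , f) = (isNode , ci≥3 , l) , f

  reaches-++ : ∀ {c σ d τ e} → c ─[ σ ]→ d → d ─[ τ ]→ e → c ─[ σ ++ τ ]→ e
  reaches-++ {c} {σ} {d} {τ} (lσ , fσ) (lτ , fτ) =
    Legal-++ c σ τ lσ (Legal-cong τ (sym ∘ fσ) lτ) ,
    λ j → trans (cong (λ c′ → c′ j) (fireAll-++ c σ τ)) (trans (fireAll-cong τ fσ j) (fτ j))

  reaches-respˡ : ∀ {c c′ σ d} → c ≗ c′ → c ─[ σ ]→ d → c′ ─[ σ ]→ d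
  reaches-respˡ {σ = σ} c≗c′ (l , f) =
    Legal-cong σ c≗c′ l , λ j → trans (sym (fireAll-cong σ c≗c′ j)) (f j)

  reaches-respʳ : ∀ {c σ d d′} → d ≗ d′ → c ─[ σ ]→ d → c ─[ σ ]→ d′
  reaches-respʳ d≗d′ (l , f) = l , λ j → trans (f j) (d≗d′ j)

  inflow : V → V → ℕ
  inflow i j = ind (does (j ≟ left i)) + ind (does (j ≟ right i)) + ind (does (j ≟ up i))

  -- The three removed chips are moved to the left so that no truncated subtraction remains.
  fire-balance : ∀ c {i} → 3 ≤ c i → ∀ j → fire c i j + 3 * ind (does (j ≟ i)) ≡ c j + inflow i j
  fire-balance c {i} ci≥3 j with j ≟ i
  ... | yes refl = trans (regroup (c j ∸ 3) _ _ _) (cong (_+ inflow j j) (m∸n+n≡m ci≥3))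
    where
    regroup : ∀ a x y z → a + x + y + z + 3 * 1 ≡ a + 3 + (x + y + z)
    regroup = solve-∀
  ... | no _ = regroup (c j) _ _ _
    where
    regroup : ∀ a x y z → a + x + y + z + 3 * 0 ≡ a + (x + y + z)
    regroup = solve-∀

  fire-≢-mono : ∀ c {i j} → j ≢ i → c j ≤ fire c i j
  fire-≢-mono c {i} {j} j≢i rewrite dec-false (j ≟ i) j≢i =
    ≤-trans (m≤m+n (c j) _) (≤-trans (m≤m+n _ _) (m≤m+n _ _))

  fireAll-∉-mono : ∀ c {i} σ → All (_≢ i) σ → c i ≤ fireAll c σ i
  fireAll-∉-mono c []      []          = ≤-refl
  fireAll-∉-mono c (j ∷ σ) (j≢i ∷ σ≢i) =
    ≤-trans (fire-≢-mono c (≢-sym j≢i)) (fireAll-∉-mono (fire c j) σ σ≢i)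

  fire-fire-balance : ∀ c {i j} → 3 ≤ c j → 3 ≤ fire c j i → ∀ x →
    fire (fire c j) i x + (3 * ind (does (x ≟ i)) + 3 * ind (does (x ≟ j))) ≡ c x + (inflow i x + inflow j x)
  fire-fire-balance c {i} {j} cj≥3 cji≥3 x = begin
    fire (fire c j) i x + (a + b)   ≡⟨ +-assoc (fire (fire c j) i x) a b ⟨
    fire (fire c j) i x + a + b     ≡⟨ cong (_+ b) (fire-balance (fire c j) cji≥3 x) ⟩
    fire c j x + inflow i x + b     ≡⟨ swap-last (fire c j x) (inflow i x) b ⟩
    fire c j x + b + inflow i x     ≡⟨ cong (_+ inflow i x) (fire-balance c cj≥3 x) ⟩
    c x + inflow j x + inflow i x   ≡⟨ +-assoc-comm (c x) (inflow j x) (inflow i x) ⟩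
    c x + (inflow i x + inflow j x) ∎
    where
    open ≡-Reasoning
    a = 3 * ind (does (x ≟ i)); b = 3 * ind (does (x ≟ j))
    swap-last : ∀ m n o → m + n + o ≡ m + o + n
    swap-last = solve-∀
    +-assoc-comm : ∀ m n o → m + n + o ≡ m + (o + n)
    +-assoc-comm = solve-∀

  fire-comm : ∀ c {i j} → 3 ≤ c i → 3 ≤ c j → 3 ≤ fire c j i → 3 ≤ fire c i j →
    fire (fire c j) i ≗ fire (fire c i) j
  fire-comm c {i} {j} ci≥3 cj≥3 cji≥3 cij≥3 x = +-cancelʳ-≡ _ _ _ (begin
    fire (fire c j) i x + (a + b)   ≡⟨ fire-fire-balance c cj≥3 cji≥3 x ⟩
    c x + (inflow i x + inflow j x) ≡⟨ cong (c x +_) (+-comm (inflow i x) (inflow j x)) ⟩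
    c x + (inflow j x + inflow i x) ≡⟨ fire-fire-balance c ci≥3 cij≥3 x ⟨
    fire (fire c i) j x + (b + a)   ≡⟨ cong (fire (fire c i) j x +_) (+-comm b a) ⟩
    fire (fire c i) j x + (a + b)   ∎)
    where
    open ≡-Reasoning
    a = 3 * ind (does (x ≟ i)); b = 3 * ind (does (x ≟ j))

  fire-first : ∀ {c i α₁ α₂ d} → 3 ≤ c i → All (_≢ i) α₁ →
    c ─[ α₁ ++ i ∷ α₂ ]→ d → fire c i ─[ α₁ ++ α₂ ]→ d
  fire-first ci≥3 [] ((_ , _ , l) , f) = l , f
  fire-first {c} ci≥3 (j≢i ∷ α₁≢i) ((isNode , cj≥3 , l) , f) =
    reaches-∷ isNode cij≥3
      (reaches-respˡ (fire-comm c ci≥3 cj≥3 cji≥3 cij≥3) (fire-first cji≥3 α₁≢i (l , f)))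
    where
    cji≥3 = ≤-trans ci≥3 (fire-≢-mono c (≢-sym j≢i))
    cij≥3 = ≤-trans cj≥3 (fire-≢-mono c j≢i)

  first-occurrence : ∀ i α → First.FirstView (_≢ i) (_≡ i) α ⊎ All (_≢ i) α
  first-occurrence i α = Sum.map₁ First.toView (First.first (λ j → Sum.swap (toSum (j ≟ i))) α)

  least-action : ∀ {c α d} β → c ─[ α ]→ d → Terminal d → Legal c β → length β ≤ length α
  least-action []      _   _        _                   = z≤n
  least-action {c} {α} (i ∷ β) c→d terminal (isNode , ci≥3 , lβ) with first-occurrence i α
  ... | inj₂ α≢i =
    contradiction (≤-trans ci≥3 (fireAll-∉-mono c α α≢i))
                  (<⇒≱ (subst (_< 3) (sym (proj₂ c→d i)) (terminal i isNode)))
  ... | inj₁ (First._++_∷_ {α₁} α₁≢i refl α₂) = begin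
    suc (length β)              ≤⟨ s≤s (least-action β (fire-first ci≥3 α₁≢i c→d) terminal lβ) ⟩
    suc (length (α₁ ++ α₂))     ≡⟨ length-++-∷ α₁ ⟨
    length (α₁ ++ i ∷ α₂)       ∎
    where
    open ≤-Reasoning
    length-++-∷ : ∀ xs → length (xs ++ i ∷ α₂) ≡ suc (length (xs ++ α₂))
    length-++-∷ []       = refl
    length-++-∷ (_ ∷ xs) = cong suc (length-++-∷ xs)

  terminal-length-unique : ∀ {c α d β e} → c ─[ α ]→ d → Terminal d → c ─[ β ]→ e → Terminal e →
    length α ≡ length β
  terminal-length-unique {β = β} c→d d-terminal c→e e-terminal = ≤-antisym
    (least-action _ c→e e-terminal (proj₁ c→d))
    (least-action β c→d d-terminal (proj₁ c→e))

module AddressTree where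

  open import Data.Nat using (_+_)
  open import Data.Nat.Properties using (+-identityʳ)
  open import Data.Nat.Tactic.RingSolver using (solve-∀)

  Address : Set
  Address = List Bool

  _≟ₐ_ : DecidableEquality Address
  _≟ₐ_ = ≡-dec Bool._≟_

  up : Address → Address
  up []          = []
  up (_ ∷ [])    = []
  up (b ∷ c ∷ q) = b ∷ up (c ∷ q)

  up-∷ʳ : ∀ q b → up (q ∷ʳ b) ≡ q
  up-∷ʳ []          b = refl
  up-∷ʳ (c ∷ [])    b = refl
  up-∷ʳ (c ∷ d ∷ q) b = cong (c ∷_) (up-∷ʳ (d ∷ q) b)

  open ChipFiring _≟ₐ_ (_∷ʳ false) (_∷ʳ true) up (λ _ → ⊤) public

  +0+0 : ∀ m → m + 0 + 0 ≡ m
  +0+0 m = trans (+-identityʳ (m + 0)) (+-identityʳ m)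

  +0+0+0 : ∀ m → m + 0 + 0 + 0 ≡ m
  +0+0+0 m = trans (+-identityʳ (m + 0 + 0)) (+0+0 m)

  fire-∷-other : ∀ c s q p → fire c (s ∷ q) (not s ∷ p) ≡ c (not s ∷ p)
  fire-∷-other c false []      p = +0+0+0 _
  fire-∷-other c false (_ ∷ _) p = +0+0+0 _
  fire-∷-other c true  []      p = +0+0+0 _
  fire-∷-other c true  (_ ∷ _) p = +0+0+0 _

  fire-∷-∷-same : ∀ c s t q p → fire c (s ∷ t ∷ q) (s ∷ p) ≡ fire (c ∘ (s ∷_)) (t ∷ q) p
  fire-∷-∷-same c false t q p = refl
  fire-∷-∷-same c true  t q p = refl

  fire-∷-∷-root : ∀ c s t q → fire c (s ∷ t ∷ q) [] ≡ c []
  fire-∷-∷-root c s t q = +0+0+0 _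

  rootChip : Configuration
  rootChip p = ind (does (p ≟ₐ []))

  -- Firing the root of a subtree sends its third chip to the root of the tree instead of back to itself.
  fire-[s]-same : ∀ c s p → fire c (s ∷ []) (s ∷ p) + rootChip p ≡ fire (c ∘ (s ∷_)) [] p
  fire-[s]-same c false p = cong (_+ rootChip p) (+-identityʳ _)
  fire-[s]-same c true  p = cong (_+ rootChip p) (+-identityʳ _)

  fire-[]-∷ : ∀ c s p → fire c [] (s ∷ p) ≡ c (s ∷ p) + rootChip p
  fire-[]-∷ c false p = regroup (c (false ∷ p)) (rootChip p)
    where
    regroup : ∀ m x → m + x + 0 + 0 ≡ m + x
    regroup = solve-∀
  fire-[]-∷ c true  p = regroup (c (true ∷ p)) (rootChip p)
    where
    regroup : ∀ m x → m + 0 + x + 0 ≡ m + x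
    regroup = solve-∀

module Construction where

  open import Data.Nat using (ℕ; zero; suc; _+_; _^_; _≤_; z≤n; s≤s)
  open import Data.Nat.Properties using (+-identityʳ; +-suc; +-comm; ≤-refl)
  open import Data.Nat.Tactic.RingSolver using (solve-∀)
  open AddressTree

  double : Configuration → Configuration
  double c []      = 1
  double c (_ ∷ p) = c p

  double-cong : ∀ {c d} → c ≗ d → double c ≗ double d
  double-cong c≗d []      = refl
  double-cong c≗d (_ ∷ p) = c≗d p

  liftMove : Address → List Address
  liftMove []        = (false ∷ []) ∷ (true ∷ []) ∷ [] ∷ []
  liftMove q@(_ ∷ _) = (false ∷ q) ∷ (true ∷ q) ∷ []

  lift : List Address → List Address
  lift = concatMap liftMove

  -- After both subtree roots have fired, the root holds 3 chips; its firing returns to each of them the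
  -- chip that the self-loop returns in the simulated tree.
  liftMove-reaches : ∀ {c} q → 3 ≤ c q → double c ─[ liftMove q ]→ double (fire c q)
  liftMove-reaches {c} [] c[]≥3 =
    (tt , c[]≥3 , tt , subst (3 ≤_) (sym (fire-∷-other (double c) false [] [])) c[]≥3 , tt , ≤-refl , tt) ,
    λ { [] → refl ; (false ∷ p) → atLeft p ; (true ∷ p) → atRight p }
    where
    c₁ = fire (double c) (false ∷ [])
    c₂ = fire c₁ (true ∷ [])
    open ≡-Reasoning
    atLeft : ∀ p → fire c₂ [] (false ∷ p) ≡ fire c [] p
    atLeft p = begin
      fire c₂ [] (false ∷ p)                                ≡⟨ fire-[]-∷ c₂ false p ⟩
      c₂ (false ∷ p) + rootChip p                           ≡⟨ cong (_+ rootChip p) (fire-∷-other c₁ true [] p) ⟩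
      fire (double c) (false ∷ []) (false ∷ p) + rootChip p ≡⟨ fire-[s]-same (double c) false p ⟩
      fire c [] p                                           ∎
    atRight : ∀ p → fire c₂ [] (true ∷ p) ≡ fire c [] p
    atRight p = begin
      fire c₂ [] (true ∷ p)                       ≡⟨ fire-[]-∷ c₂ true p ⟩
      fire c₁ (true ∷ []) (true ∷ p) + rootChip p ≡⟨ fire-[s]-same c₁ true p ⟩
      fire (c₁ ∘ (true ∷_)) [] p                  ≡⟨ fire-cong [] (fire-∷-other (double c) false []) p ⟩
      fire c [] p                                 ∎
  liftMove-reaches {c} q@(t ∷ q′) cq≥3 =
    (tt , cq≥3 , tt , subst (3 ≤_) (sym (fire-∷-other (double c) false q q)) cq≥3 , tt) ,
    λ { [] → atRoot ; (false ∷ p) → atLeft p ; (true ∷ p) → atRight p }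
    where
    c₁ = fire (double c) (false ∷ q)
    c₂ = fire c₁ (true ∷ q)
    open ≡-Reasoning
    atRoot : c₂ [] ≡ 1
    atRoot = trans (fire-∷-∷-root c₁ true t q′) (fire-∷-∷-root (double c) false t q′)
    atLeft : ∀ p → c₂ (false ∷ p) ≡ fire c q p
    atLeft p = trans (fire-∷-other c₁ true q p) (fire-∷-∷-same (double c) false t q′ p)
    atRight : ∀ p → c₂ (true ∷ p) ≡ fire c q p
    atRight p = trans (fire-∷-∷-same c₁ true t q′ p) (fire-cong q (fire-∷-other (double c) false q) p)

  lift-reaches : ∀ {c d} σ → c ─[ σ ]→ d → double c ─[ lift σ ]→ double d
  lift-reaches []      (_ , c≗d)              = reaches-[] (double-cong c≗d)
  lift-reaches (q ∷ σ) ((_ , cq≥3 , l) , f) = reaches-++ (liftMove-reaches q cq≥3) (lift-reaches σ (l , f))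

  twoLevel : ℕ → ℕ → Configuration
  twoLevel r t []          = r
  twoLevel r t (_ ∷ [])    = t
  twoLevel r t (_ ∷ _ ∷ _) = 0

  fire-root-twoLevel : ∀ r t → fire (twoLevel (3 + r) t) [] ≗ twoLevel (suc r) (suc t)
  fire-root-twoLevel r t []             = trans (cong (_+ 1) (+0+0 r)) (+-comm r 1)
  fire-root-twoLevel r t (false ∷ [])   = trans (+0+0 (t + 1)) (+-comm t 1)
  fire-root-twoLevel r t (true ∷ [])    =
    trans (+-identityʳ (t + 0 + 1)) (trans (cong (_+ 1) (+-identityʳ t)) (+-comm t 1))
  fire-root-twoLevel r t (false ∷ _ ∷ _) = refl
  fire-root-twoLevel r t (true ∷ _ ∷ _)  = refl

  root-phase : ∀ j t → twoLevel (suc (j + j)) t ─[ replicate j [] ]→ twoLevel 1 (t + j)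
  root-phase zero    t = reaches-[] (λ p → cong (λ t → twoLevel 1 t p) (sym (+-identityʳ t)))
  root-phase (suc j) t rewrite +-suc j j =
    reaches-∷ tt (s≤s (s≤s (s≤s z≤n)))
      (reaches-respˡ (sym ∘ fire-root-twoLevel (j + j) t)
        (reaches-respʳ (λ p → cong (λ t → twoLevel 1 t p) (sym (+-suc t j))) (root-phase j (suc t))))

  mersenne : ℕ → ℕ
  mersenne zero    = 0
  mersenne (suc n) = suc (mersenne n + mersenne n)

  fullTree : ℕ → Configuration
  fullTree zero    = λ _ → 0
  fullTree (suc n) = double (fullTree n)

  canonical : ℕ → List Address
  canonical zero    = []
  canonical (suc n) = replicate (mersenne n) [] ++ lift (canonical n)

  twoLevel-double : ∀ m → twoLevel 1 m ≗ double (twoLevel m 0)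
  twoLevel-double m []              = refl
  twoLevel-double m (_ ∷ [])        = refl
  twoLevel-double m (_ ∷ _ ∷ [])    = refl
  twoLevel-double m (_ ∷ _ ∷ _ ∷ _) = refl

  canonical-reaches : ∀ n → twoLevel (mersenne n) 0 ─[ canonical n ]→ fullTree n
  canonical-reaches zero = reaches-[] λ { [] → refl ; (_ ∷ []) → refl ; (_ ∷ _ ∷ _) → refl }
  canonical-reaches (suc n) =
    reaches-++ (root-phase (mersenne n) 0)
      (reaches-respˡ (sym ∘ twoLevel-double (mersenne n)) (lift-reaches (canonical n) (canonical-reaches n)))

  fullTree-terminal : ∀ n → Terminal (fullTree n)
  fullTree-terminal zero    p       _ = s≤s z≤n
  fullTree-terminal (suc n) []      _ = s≤s (s≤s z≤n)
  fullTree-terminal (suc n) (_ ∷ p) _ = fullTree-terminal n p tt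

  rootMoves : List Address → ℕ
  rootMoves []            = 0
  rootMoves ([] ∷ σ)      = suc (rootMoves σ)
  rootMoves ((_ ∷ _) ∷ σ) = rootMoves σ

  rootMoves-++ : ∀ σ τ → rootMoves (σ ++ τ) ≡ rootMoves σ + rootMoves τ
  rootMoves-++ []            τ = refl
  rootMoves-++ ([] ∷ σ)      τ = cong suc (rootMoves-++ σ τ)
  rootMoves-++ ((_ ∷ _) ∷ σ) τ = rootMoves-++ σ τ

  rootMoves-replicate : ∀ m → rootMoves (replicate m []) ≡ m
  rootMoves-replicate zero    = refl
  rootMoves-replicate (suc m) = cong suc (rootMoves-replicate m)

  rootMoves-lift : ∀ σ → rootMoves (lift σ) ≡ rootMoves σ
  rootMoves-lift []            = refl
  rootMoves-lift ([] ∷ σ)      = cong suc (rootMoves-lift σ)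
  rootMoves-lift ((_ ∷ _) ∷ σ) = rootMoves-lift σ

  length-lift : ∀ σ → length (lift σ) ≡ length σ + length σ + rootMoves σ
  length-lift []            = refl
  length-lift ([] ∷ σ)      = trans (cong (3 +_) (length-lift σ)) (regroup (length σ) (rootMoves σ))
    where
    regroup : ∀ l r → 3 + (l + l + r) ≡ suc l + suc l + suc r
    regroup = solve-∀
  length-lift ((_ ∷ _) ∷ σ) = trans (cong (2 +_) (length-lift σ)) (regroup (length σ) (rootMoves σ))
    where
    regroup : ∀ l r → 2 + (l + l + r) ≡ suc l + suc l + r
    regroup = solve-∀

  rootMoves-canonical-suc : ∀ n → rootMoves (canonical (suc n)) ≡ mersenne n + rootMoves (canonical n)
  rootMoves-canonical-suc n =
    trans (rootMoves-++ (replicate (mersenne n) []) (lift (canonical n)))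
          (cong₂ _+_ (rootMoves-replicate (mersenne n)) (rootMoves-lift (canonical n)))

  length-canonical-suc : ∀ n → length (canonical (suc n)) ≡
    mersenne n + (length (canonical n) + length (canonical n) + rootMoves (canonical n))
  length-canonical-suc n =
    trans (length-++ (replicate (mersenne n) []))
          (cong₂ _+_ (length-replicate (mersenne n)) (length-lift (canonical n)))

  suc-mersenne : ∀ n → suc (mersenne n) ≡ 2 ^ n
  suc-mersenne zero    = refl
  suc-mersenne (suc n) = trans (regroup (mersenne n)) (cong (λ m → m + (m + 0)) (suc-mersenne n))
    where
    regroup : ∀ m → suc (suc (m + m)) ≡ suc m + (suc m + 0)
    regroup = solve-∀

module LabelledTree where

  open import Data.Nat using (ℕ; zero; suc; _+_; _*_; _^_; _∸_; _/_; _≤_; _<_; z≤n; s≤s)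
  open import Data.Nat.Properties
    using ( _≟_; ≤-trans; m≤m+n; m≤n+m; m<n⇒n≢0; *-monoʳ-≤; *-cancelˡ-≡; *-comm; *-suc; +-comm
          ; suc-injective; even≢odd )
  open import Data.Nat.DivMod using (m*n/n≡m; +-distrib-/-∣ʳ)
  open import Data.Nat.Divisibility using (m∣m*n)
  open import Data.List using (reverse; map)
  open import Data.List.Properties using (reverse-++; reverse-involutive; reverse-injective; length-map)
  open import Data.List.Reverse using (reverseView; _∶_∶ʳ_)
  import Data.List.Reverse as Reverse
  open Defs using (parent; initial; LegalSeq)
  open AddressTree
  open Construction

  module ℕTree = ChipFiring _≟_ (2 *_) (λ i → 2 * i + 1) parent (1 ≤_)

  -- The label of a node is the number whose binary digits are 1 followed by its address.
  nodeʳ : List Bool → ℕ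
  nodeʳ []      = 1
  nodeʳ (b ∷ r) = ind b + 2 * nodeʳ r

  node : Address → ℕ
  node p = nodeʳ (reverse p)

  nodeʳ-positive : ∀ r → 1 ≤ nodeʳ r
  nodeʳ-positive []      = s≤s z≤n
  nodeʳ-positive (b ∷ r) = ≤-trans (nodeʳ-positive r) (≤-trans (m≤m+n (nodeʳ r) _) (m≤n+m _ (ind b)))

  node-positive : ∀ p → 1 ≤ node p
  node-positive p = nodeʳ-positive (reverse p)

  bit+double-injective : ∀ a b m n → ind a + 2 * m ≡ ind b + 2 * n → a ≡ b × m ≡ n
  bit+double-injective false false m n e = refl , *-cancelˡ-≡ m n 2 e
  bit+double-injective true  true  m n e = refl , *-cancelˡ-≡ m n 2 (suc-injective e)
  bit+double-injective false true  m n e = contradiction e (even≢odd m n)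
  bit+double-injective true  false m n e = contradiction (sym e) (even≢odd n m)

  nodeʳ-injective : ∀ r s → nodeʳ r ≡ nodeʳ s → r ≡ s
  nodeʳ-injective []      []      _ = refl
  nodeʳ-injective []      (b ∷ s) e =
    contradiction (sym (proj₂ (bit+double-injective true b 0 (nodeʳ s) e))) (m<n⇒n≢0 (nodeʳ-positive s))
  nodeʳ-injective (a ∷ r) []      e =
    contradiction (proj₂ (bit+double-injective a true (nodeʳ r) 0 e)) (m<n⇒n≢0 (nodeʳ-positive r))
  nodeʳ-injective (a ∷ r) (b ∷ s) e with bit+double-injective a b (nodeʳ r) (nodeʳ s) e
  ... | refl , eʳ = cong (a ∷_) (nodeʳ-injective r s eʳ)

  node-injective : ∀ p q → node p ≡ node q → p ≡ q
  node-injective p q e = reverse-injective (nodeʳ-injective (reverse p) (reverse q) e)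

  node-≟ : ∀ p q → does (node p ≟ node q) ≡ does (p ≟ₐ q)
  node-≟ p q with p ≟ₐ q
  ... | yes refl = dec-true (node p ≟ node p) refl
  ... | no p≢q   = dec-false (node p ≟ node q) (p≢q ∘ node-injective p q)

  increment : List Bool → List Bool
  increment []          = false ∷ []
  increment (false ∷ r) = true ∷ r
  increment (true ∷ r)  = false ∷ increment r

  nodeʳ-increment : ∀ r → nodeʳ (increment r) ≡ suc (nodeʳ r)
  nodeʳ-increment []          = refl
  nodeʳ-increment (false ∷ r) = refl
  nodeʳ-increment (true ∷ r)  = trans (cong (2 *_) (nodeʳ-increment r)) (*-suc 2 (nodeʳ r))

  node-surjective : ∀ v → 1 ≤ v → ∃[ p ] node p ≡ v
  node-surjective (suc v) _ =
    reverse (counter v) , trans (cong nodeʳ (reverse-involutive (counter v))) (nodeʳ-counter v)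
    where
    counter : ℕ → List Bool
    counter zero    = []
    counter (suc v) = increment (counter v)
    nodeʳ-counter : ∀ v → nodeʳ (counter v) ≡ suc v
    nodeʳ-counter zero    = refl
    nodeʳ-counter (suc v) = trans (nodeʳ-increment (counter v)) (cong suc (nodeʳ-counter v))

  node-∷ʳ : ∀ q b → node (q ∷ʳ b) ≡ ind b + 2 * node q
  node-∷ʳ q b = cong nodeʳ (reverse-++ q (b ∷ []))

  parent-bit+double : ∀ b x → 1 ≤ x → parent (ind b + 2 * x) ≡ x
  parent-bit+double b x x≥1 = begin
    parent (ind b + 2 * x)     ≡⟨ parent-≥2 (ind b + 2 * x) bit+double≥2 ⟩
    (ind b + 2 * x) / 2        ≡⟨ +-distrib-/-∣ʳ (ind b) (m∣m*n x) ⟩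
    ind b / 2 + 2 * x / 2      ≡⟨ cong₂ _+_ (bit/2 b) (cong (_/ 2) (*-comm 2 x)) ⟩
    x * 2 / 2                  ≡⟨ m*n/n≡m x 2 ⟩
    x                          ∎
    where
    open ≡-Reasoning
    bit+double≥2 : 2 ≤ ind b + 2 * x
    bit+double≥2 = ≤-trans (*-monoʳ-≤ 2 x≥1) (m≤n+m (2 * x) (ind b))
    parent-≥2 : ∀ m → 2 ≤ m → parent m ≡ m / 2
    parent-≥2 (suc (suc m)) _         = refl
    parent-≥2 (suc zero)    (s≤s ())
    bit/2 : ∀ b → ind b / 2 ≡ 0
    bit/2 false = refl
    bit/2 true  = refl

  parent-node : ∀ q → parent (node q) ≡ node (up q)
  parent-node q with reverseView q
  ... | Reverse.[] = refl
  ... | q′ ∶ _ ∶ʳ b = begin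
    parent (node (q′ ∷ʳ b))       ≡⟨ cong parent (node-∷ʳ q′ b) ⟩
    parent (ind b + 2 * node q′)  ≡⟨ parent-bit+double b (node q′) (node-positive q′) ⟩
    node q′                       ≡⟨ cong node (up-∷ʳ q′ b) ⟨
    node (up (q′ ∷ʳ b))           ∎
    where open ≡-Reasoning

  does-node-≟ : ∀ p {q v} → node q ≡ v → does (node p ≟ v) ≡ does (p ≟ₐ q)
  does-node-≟ p {q} refl = node-≟ p q

  fire-node : ∀ C q p → ℕTree.fire C (node q) (node p) ≡ fire (C ∘ node) q p
  fire-node C q p
    rewrite node-≟ p q
          | does-node-≟ p {q ∷ʳ false} (node-∷ʳ q false)
          | does-node-≟ p {q ∷ʳ true} (trans (node-∷ʳ q true) (+-comm 1 (2 * node q)))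
          | does-node-≟ p {up q} (sym (parent-node q)) = refl

  simulate : ∀ {C c d} σ → C ∘ node ≗ c → c ─[ σ ]→ d →
    ℕTree.Legal C (map node σ) × ℕTree.fireAll C (map node σ) ∘ node ≗ d
  simulate []      C≗c (_ , f)                  = tt , λ p → trans (C≗c p) (f p)
  simulate {C} (q ∷ σ) C≗c ((_ , cq≥3 , l) , f) =
    let lℕ , fℕ = simulate σ (λ p → trans (fire-node C q p) (fire-cong q C≗c p)) (l , f)
    in (node-positive q , subst (3 ≤_) (sym (C≗c q)) cq≥3 , lℕ) , fℕ

  terminal-node : ∀ {D d} → D ∘ node ≗ d → Terminal d → ℕTree.Terminal D
  terminal-node D≗d d-terminal v v≥1 with node-surjective v v≥1
  ... | p , refl = subst (_< 3) (sym (D≗d p)) (d-terminal p tt)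

  initial-node : ∀ n → initial n ∘ node ≗ twoLevel (mersenne n) 0
  initial-node n p = trans (cong (λ b → if b then 2 ^ n ∸ 1 else 0) (node-≟ p [])) (atRoot p)
    where
    atRoot : ∀ p → (if does (p ≟ₐ []) then 2 ^ n ∸ 1 else 0) ≡ twoLevel (mersenne n) 0 p
    atRoot []          = cong (_∸ 1) (sym (suc-mersenne n))
    atRoot (_ ∷ [])    = refl
    atRoot (_ ∷ _ ∷ _) = refl

  LegalSeq≡Legal : ∀ c σ → LegalSeq c σ ≡ ℕTree.Legal c σ
  LegalSeq≡Legal c []      = refl
  LegalSeq≡Legal c (i ∷ σ) = cong (λ L → 1 ≤ i × 3 ≤ c i × L) (LegalSeq≡Legal (Defs.fire c i) σ)

  fireAll≡fireAll : ∀ c σ → Defs.fireAll c σ ≡ ℕTree.fireAll c σ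
  fireAll≡fireAll c []      = refl
  fireAll≡fireAll c (i ∷ σ) = fireAll≡fireAll (Defs.fire c i) σ

  length-complete-sequence : ∀ n moves →
    LegalSeq (initial n) moves → Defs.Terminal (Defs.fireAll (initial n) moves) →
    length moves ≡ length (canonical n)
  length-complete-sequence n moves legal terminal =
    trans (ℕTree.terminal-length-unique
             (subst id (LegalSeq≡Legal (initial n) moves) legal , λ _ → refl)
             (subst ℕTree.Terminal (fireAll≡fireAll (initial n) moves) terminal)
             (proj₁ canonicalℕ , λ _ → refl)
             (terminal-node (proj₂ canonicalℕ) (fullTree-terminal n)))
          (length-map node (canonical n))
    where
    canonicalℕ = simulate (canonical n) (initial-node n) (canonical-reaches n)

module Counting where

  open import Data.Nat using (zero; suc)
  open import Data.Integer using (+_; _+_; _*_; _-_)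
  open import Data.Integer.Tactic.RingSolver using (solve-∀)
  open Construction using (canonical; mersenne; rootMoves; rootMoves-canonical-suc; length-canonical-suc)
  open ≡-Reasoning

  rootMoves-canonical : ∀ n → + rootMoves (canonical n) ≡ + mersenne n - + n
  rootMoves-canonical zero    = refl
  rootMoves-canonical (suc n) = begin
    + rootMoves (canonical (suc n))          ≡⟨ cong +_ (rootMoves-canonical-suc n) ⟩
    μ + + rootMoves (canonical n)            ≡⟨ cong (λ ρ → μ + ρ) (rootMoves-canonical n) ⟩
    μ + (μ - + n)                            ≡⟨ regroup μ (+ n) ⟩
    + 1 + (μ + μ) - (+ 1 + + n)              ∎
    where
    μ = + mersenne n
    regroup : ∀ μ ν → μ + (μ - ν) ≡ + 1 + (μ + μ) - (+ 1 + ν)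
    regroup = solve-∀

  length-canonical : ∀ n → + length (canonical n) ≡ + suc (mersenne n) * (+ n - + 3) + + n + + 3
  length-canonical zero    = refl
  length-canonical (suc n) = begin
    + length (canonical (suc n))             ≡⟨ cong +_ (length-canonical-suc n) ⟩
    μ + (ℓ + ℓ + + rootMoves (canonical n))
      ≡⟨ cong₂ (λ ℓ ρ → μ + (ℓ + ℓ + ρ)) (length-canonical n) (rootMoves-canonical n) ⟩
    μ + (L + L + (μ - + n))                  ≡⟨ regroup μ (+ n) ⟩
    (+ 1 + (+ 1 + (μ + μ))) * (+ 1 + + n - + 3) + (+ 1 + + n) + + 3 ∎
    where
    μ = + mersenne n
    ℓ = + length (canonical n)
    L = (+ 1 + μ) * (+ n - + 3) + + n + + 3
    regroup : ∀ μ ν →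
      μ + ( ((+ 1 + μ) * (ν - + 3) + ν + + 3)
          + ((+ 1 + μ) * (ν - + 3) + ν + + 3)
          + (μ - ν))
      ≡ (+ 1 + (+ 1 + (μ + μ))) * (+ 1 + ν - + 3) + (+ 1 + ν) + + 3
    regroup = solve-∀

open Defs using (LegalSeq; fireAll; Terminal; initial)
open Construction using (canonical; mersenne; suc-mersenne)
open LabelledTree using (length-complete-sequence)
open Counting using (length-canonical)
open import Data.Nat using (ℕ; suc; _≤_; _^_)
open import Data.Integer using (ℤ; +_; _+_; _*_; _-_)

corollary3p7 : (n : ℕ) → 1 ≤ n → (moves : List ℕ) →
    LegalSeq (initial n) moves → Terminal (fireAll (initial n) moves) →
    + (length moves) ≡ (+ (2 ^ n)) * (+ n - + 3) + + n + + 3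
corollary3p7 n _ moves legal terminal = begin
  + length moves                               ≡⟨ cong +_ (length-complete-sequence n moves legal terminal) ⟩
  + length (canonical n)                       ≡⟨ length-canonical n ⟩
  + suc (mersenne n) * (+ n - + 3) + + n + + 3 ≡⟨ cong (λ m → + m * (+ n - + 3) + + n + + 3) (suc-mersenne n) ⟩
  + (2 ^ n) * (+ n - + 3) + + n + + 3          ∎
  where open ≡-Reasoning
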